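{- Let $M=(N,\mathcal{I})$ be a laminar matroid given by a laminar family $\mathcal{L}$ with bounds $b_L\ge1$ and $N\in\mathcal{L}$, with $N=\{f_1,\dots,f_n\}$ numbered so that each $L\in\mathcal{L}$ consists of consecutively numbered elements. Let $I\in\mathcal{I}$ with $I\neq\emptyset$. Then each set $N_{f_i}$ of the partition $\widetilde{\mathcal{P}}(I)=\{N_{f_i}\mid f_i\in I\}$ (see context) is of the form $N_{f_i}=\{f_j,f_{j+1},\dots,f_k\}$ for some $1\le j\le i\le k\le n$.
   Context: Laminar matroid: $\mathcal{L}\subseteq2^N$ laminar (members pairwise disjoint or nested), $\mathcal{I}=\{J\subseteq N\mid |J\cap L|\le b_L\ \forall L\in\mathcal{L}\}$. Partition $\widetilde{\mathcal{P}}(I)$ for non-empty $I\in\mathcal{I}$: for each element $f_i\in N$, let $L\in\mathcal{L}$ be the smallest set of $\mathcal{L}$ containing $f_i$ with $L\cap I\neq\emptyset$. If $L\cap I$ contains some $f_j$ with $j\le i$, let $j$ be the largest such index; otherwise let $j$ be the smallest index $j>i$ with $f_j\in L\cap I$. Then $f_i$ is assigned to the set $N_{f_j}$. The sets $N_f$, $f\in I$, form $\widetilde{\mathcal{P}}(I)$. -}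

module Defs where

open import Data.Nat using (ℕ; suc)
open import Data.Fin using (Fin; _≤_; _<_)
open import Data.Fin.Subset using (Subset; _∈_; _∉_; _⊆_; _∩_; ∣_∣; Nonempty; Empty; ⊤)
open import Data.Product using (Σ; ∃; _×_)
open import Data.Sum using (_⊎_)
open import Relation.Nullary using (¬_)
open import Relation.Binary.PropositionalEquality using (_≡_)

-- Ground set N = {f_1,...,f_n} is Fin n (f_i ↔ index i-1); the numbering is the order on Fin n.

Laminar : ∀ {m n} → (Fin m → Subset n) → Set
Laminar {m} ℒ = ∀ (a c : Fin m) → Empty (ℒ a ∩ ℒ c) ⊎ (ℒ a ⊆ ℒ c ⊎ ℒ c ⊆ ℒ a)

Consecutive : ∀ {m n} → (Fin m → Subset n) → Set
Consecutive {m} {n} ℒ = ∀ (a : Fin m) (x y z : Fin n) →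
  x ∈ ℒ a → z ∈ ℒ a → x ≤ y → y ≤ z → y ∈ ℒ a

Independent : ∀ {m n} → (Fin m → Subset n) → (Fin m → ℕ) → Subset n → Set
Independent {m} ℒ b J = ∀ (a : Fin m) → ∣ J ∩ ℒ a ∣ Data.Nat.≤ b a

ChosenIn : ∀ {n} → Subset n → Fin n → Fin n → Set
ChosenIn {n} S i f =
  (f ∈ S × f ≤ i × (∀ (g : Fin n) → g ∈ S → g ≤ i → g ≤ f))
  ⊎ ((∀ (g : Fin n) → g ∈ S → i < g) × f ∈ S × i < f × (∀ (g : Fin n) → g ∈ S → f ≤ g))

SmallestFor : ∀ {m n} → (Fin m → Subset n) → Subset n → Fin n → Fin m → Set
SmallestFor {m} ℒ I i a =
  i ∈ ℒ a × Nonempty (ℒ a ∩ I) ×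
  (∀ (c : Fin m) → i ∈ ℒ c → Nonempty (ℒ c ∩ I) → ℒ a ⊆ ℒ c)

-- Assigned ℒ I i f : f_i is assigned to the set N_f of the partition P̃(I).
Assigned : ∀ {m n} → (Fin m → Subset n) → Subset n → Fin n → Fin n → Set
Assigned {m} ℒ I i f = Σ (Fin m) λ a → SmallestFor ℒ I i a × ChosenIn (ℒ a ∩ I) i f

module Submission where

open import Defs
open import Data.Nat using (ℕ; _≥_)
open import Data.Fin using (Fin; _≤_)
open import Data.Fin.Subset using (Subset; _∈_; Nonempty; ⊤)
open import Data.Product using (Σ; ∃; _×_)
open import Relation.Binary.PropositionalEquality using (_≡_)

import Data.Nat as ℕ
import Data.Nat.Properties as ℕ
open import Data.Empty using (⊥; ⊥-elim)
open import Data.Fin using (zero; suc; _<_)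
open import Data.Fin.Properties using (≤-refl; ≤-trans; ≤-total; ≤-antisym; _≤?_; _<?_; _≟_; any?)
open import Data.Fin.Subset using (_⊆_; _∩_; ∣_∣; Empty)
open import Data.Fin.Subset.Properties using (_∈?_; nonempty?; ∈⊤; x∈p∩q⁺; x∈p∩q⁻; p⊂q⇒∣p∣<∣q∣)
open import Data.Product using (_,_; proj₁; proj₂)
open import Data.Sum using (_⊎_; inj₁; inj₂; reduce)
open import Function using (_∘_; id)
open import Relation.Binary using (Rel; Transitive; Total)
open import Relation.Nullary using (yes; no; contradiction)
open import Relation.Nullary.Decidable using (map′; _×-dec_)
open import Relation.Unary using (Pred; Decidable)
open import Relation.Binary.PropositionalEquality using (refl; subst)

-- The assignment x ↦ f of the partition P̃(I) is a total, monotone map on the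
-- numbering, so each of its fibres is an interval.  Monotonicity is the heart:
-- if x ≤ y were sent to f > h, compare the smallest sets A ∋ x and C ∋ y of
-- the laminar family.  Disjoint A and C contradict consecutiveness; if one
-- contains the other, then f or h lies in the larger set on the "wrong side"
-- and the choice rule would have preferred it.

module _ {a ℓ} {A : Set a} {_≼_ : Rel A ℓ}
         (≼-trans : Transitive _≼_) (≼-total : Total _≼_) where

  Minimiser : ∀ {m p} → Pred (Fin m) p → (Fin m → A) → Set _
  Minimiser P μ = ∃ λ d → P d × ∀ c → P c → μ d ≼ μ c

  private
    ≼-refl : ∀ {x} → x ≼ x
    ≼-refl = reduce (≼-total _ _)

    minimiser-withZero : ∀ {m p} {P : Pred (Fin (ℕ.suc m)) p} {μ : Fin (ℕ.suc m) → A} →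
      P zero → Minimiser (P ∘ suc) (μ ∘ suc) → Minimiser P μ
    minimiser-withZero {μ = μ} P0 (d , Pd , min) with ≼-total (μ zero) (μ (suc d))
    ... | inj₁ μ0≼ = zero , P0 , λ { zero _ → ≼-refl
                                   ; (suc c) Pc → ≼-trans μ0≼ (min c Pc) }
    ... | inj₂ ≼μ0 = suc d , Pd , λ { zero _ → ≼μ0 ; (suc c) → min c }

  minimiser : ∀ {m p} {P : Pred (Fin m) p} → Decidable P → (μ : Fin m → A) → ∃ P → Minimiser P μ
  minimiser P? μ (zero , P0) with any? (P? ∘ suc)
  ... | no ¬tail = zero , P0 , λ { zero _ → ≼-refl
                                 ; (suc c) Pc → contradiction (c , Pc) ¬tail }
  ... | yes tail = minimiser-withZero P0 (minimiser (P? ∘ suc) (μ ∘ suc) tail)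
  minimiser P? μ (suc i , Pi) with P? zero | minimiser (P? ∘ suc) (μ ∘ suc) (i , Pi)
  ... | yes P0 | minTail = minimiser-withZero P0 minTail
  ... | no ¬P0 | d , Pd , min = suc d , Pd , λ { zero P0 → contradiction P0 ¬P0 ; (suc c) → min c }

module _ {n p} {P : Pred (Fin n) p} (P? : Decidable P) where

  least : ∃ P → ∃ λ d → P d × ∀ c → P c → d ≤ c
  least = minimiser ≤-trans ≤-total P? id

  greatest : ∃ P → ∃ λ d → P d × ∀ c → P c → c ≤ d
  greatest = minimiser (λ j≥i k≥j → ≤-trans k≥j j≥i) (λ i j → ≤-total j i) P? id

p⊆q∧∣q∣≤∣p∣⇒q⊆p : ∀ {n} {p q : Subset n} → p ⊆ q → ∣ q ∣ ℕ.≤ ∣ p ∣ → q ⊆ p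
p⊆q∧∣q∣≤∣p∣⇒q⊆p {p = p} p⊆q ∣q∣≤∣p∣ {x} x∈q with x ∈? p
... | yes x∈p = x∈p
... | no x∉p = contradiction ∣q∣≤∣p∣ (ℕ.<⇒≱ (p⊂q⇒∣p∣<∣q∣ (p⊆q , x , x∈q , x∉p)))

module _ {ℓ} {n k : ℕ} (R : Fin n → Fin k → Set ℓ) (total : ∀ x → ∃ (R x))
         (monotone : ∀ {x y f h} → x ≤ y → R x f → R y h → f ≤ h) where

  functional : ∀ {x f g} → R x f → R x g → f ≡ g
  functional Rxf Rxg = ≤-antisym (monotone ≤-refl Rxf Rxg) (monotone ≤-refl Rxg Rxf)

  fibre? : ∀ f → Decidable (λ x → R x f)
  fibre? f x with total x
  ... | g , Rxg = map′ (λ g≡f → subst (R x) g≡f Rxg) (functional Rxg) (g ≟ f)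

  fibre-isInterval : ∀ {x₀ f} → R x₀ f →
    Σ (Fin n) λ j → Σ (Fin n) λ k → j ≤ x₀ × x₀ ≤ k ×
      (∀ (x : Fin n) → (R x f → j ≤ x × x ≤ k) × (j ≤ x × x ≤ k → R x f))
  fibre-isInterval {x₀} {f} Rx₀f with least (fibre? f) (x₀ , Rx₀f) | greatest (fibre? f) (x₀ , Rx₀f)
  ... | j , Rjf , j-least | k , Rkf , k-greatest =
    j , k , j-least x₀ Rx₀f , k-greatest x₀ Rx₀f ,
    λ x → (λ Rxf → j-least x Rxf , k-greatest x Rxf) , λ { (j≤x , x≤k) → between x j≤x x≤k }
    where
    between : ∀ x → j ≤ x → x ≤ k → R x f
    between x j≤x x≤k with total x
    ... | g , Rxg = subst (R x) (≤-antisym (monotone x≤k Rxg Rkf) (monotone j≤x Rjf Rxg)) Rxg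

module _ {n : ℕ} {S : Subset n} {i f : Fin n} where

  chosenIn-∈ : ChosenIn S i f → f ∈ S
  chosenIn-∈ (inj₁ (f∈S , _)) = f∈S
  chosenIn-∈ (inj₂ (_ , f∈S , _)) = f∈S

  chosenIn-max-below : ChosenIn S i f → ∀ {g} → g ∈ S → g ≤ i → g ≤ f
  chosenIn-max-below (inj₁ (_ , _ , max)) g∈S g≤i = max _ g∈S g≤i
  chosenIn-max-below (inj₂ (allAbove , _)) g∈S g≤i = contradiction g≤i (ℕ.<⇒≱ (allAbove _ g∈S))

  chosenIn-min-above : ChosenIn S i f → i < f → ∀ {g} → g ∈ S → f ≤ g
  chosenIn-min-above (inj₁ (_ , f≤i , _)) i<f g∈S = contradiction f≤i (ℕ.<⇒≱ i<f)
  chosenIn-min-above (inj₂ (_ , _ , _ , min)) i<f g∈S = min _ g∈S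

chosenIn-refl : ∀ {n} {S : Subset n} {i} → i ∈ S → ChosenIn S i i
chosenIn-refl i∈S = inj₁ (i∈S , ≤-refl , λ _ _ g≤i → g≤i)

chosenIn-exists : ∀ {n} {S : Subset n} → Nonempty S → ∀ i → ∃ (ChosenIn S i)
chosenIn-exists {S = S} nonempty i with any? (λ g → (g ∈? S) ×-dec (g ≤? i))
... | yes below with greatest (λ g → (g ∈? S) ×-dec (g ≤? i)) below
...   | f , (f∈S , f≤i) , max = f , inj₁ (f∈S , f≤i , λ g g∈S g≤i → max g (g∈S , g≤i))
chosenIn-exists {S = S} nonempty i | no ¬below with least (_∈? S) nonempty
... | f , f∈S , min = f , inj₂ (allAbove , f∈S , allAbove f f∈S , min)
  where
  allAbove : ∀ g → g ∈ S → i < g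
  allAbove g g∈S with g ≤? i
  ... | yes g≤i = contradiction (g , g∈S , g≤i) ¬below
  ... | no g≰i = ℕ.≰⇒> g≰i

∈-≡⊤ : ∀ {n} {p : Subset n} {x} → p ≡ ⊤ → x ∈ p
∈-≡⊤ refl = ∈⊤

module _ {m n : ℕ} {ℒ : Fin m → Subset n} (laminar : Laminar ℒ) {I : Subset n} where

  candidate? : ∀ x → Decidable (λ c → x ∈ ℒ c × Nonempty (ℒ c ∩ I))
  candidate? x c = (x ∈? ℒ c) ×-dec nonempty? (ℒ c ∩ I)

  smallestFor-exists : (∃ λ a → ℒ a ≡ ⊤) → Nonempty I → ∀ x → ∃ (SmallestFor ℒ I x)
  smallestFor-exists (top , ℒtop≡⊤) (y , y∈I) x
    with minimiser ℕ.≤-trans ℕ.≤-total (candidate? x) (∣_∣ ∘ ℒ)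
           (top , ∈-≡⊤ ℒtop≡⊤ , y , x∈p∩q⁺ (∈-≡⊤ ℒtop≡⊤ , y∈I))
  ... | a , (x∈A , A∩I≢∅) , smallest = a , x∈A , A∩I≢∅ , below
    where
    below : ∀ c → x ∈ ℒ c → Nonempty (ℒ c ∩ I) → ℒ a ⊆ ℒ c
    below c x∈C C∩I≢∅ with laminar a c
    ... | inj₁ disjoint = contradiction (x , x∈p∩q⁺ (x∈A , x∈C)) disjoint
    ... | inj₂ (inj₁ A⊆C) = A⊆C
    ... | inj₂ (inj₂ C⊆A) = p⊆q∧∣q∣≤∣p∣⇒q⊆p C⊆A (smallest c (x∈C , C∩I≢∅))

  assigned-exists : (∃ λ a → ℒ a ≡ ⊤) → Nonempty I → ∀ x → ∃ (Assigned ℒ I x)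
  assigned-exists top nonempty x with smallestFor-exists top nonempty x
  ... | a , smallestFor@(_ , A∩I≢∅ , _) with chosenIn-exists A∩I≢∅ x
  ...   | f , chosen = f , a , smallestFor , chosen

  assigned-refl : (∃ λ a → ℒ a ≡ ⊤) → ∀ {f} → f ∈ I → Assigned ℒ I f f
  assigned-refl top {f} f∈I with smallestFor-exists top (f , f∈I) f
  ... | a , smallestFor@(f∈A , _) = a , smallestFor , chosenIn-refl (x∈p∩q⁺ (f∈A , f∈I))

  assigned-monotone : Consecutive ℒ → ∀ {x y f h} → x ≤ y → Assigned ℒ I x f → Assigned ℒ I y h → f ≤ h
  assigned-monotone consecutive {x} {y} {f} {h} x≤y (a , (x∈A , A∩I≢∅ , _) , chf) (c , (y∈C , _ , minC) , chh)
    with f ≤? h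
  ... | yes f≤h = f≤h
  ... | no f≰h = ⊥-elim (noCrossing (laminar a c) (ℕ.≰⇒> f≰h))
    where
    f∈A : f ∈ ℒ a
    f∈A = proj₁ (x∈p∩q⁻ (ℒ a) I (chosenIn-∈ chf))
    f∈I : f ∈ I
    f∈I = proj₂ (x∈p∩q⁻ (ℒ a) I (chosenIn-∈ chf))
    h∈C : h ∈ ℒ c
    h∈C = proj₁ (x∈p∩q⁻ (ℒ c) I (chosenIn-∈ chh))
    h∈I : h ∈ I
    h∈I = proj₂ (x∈p∩q⁻ (ℒ c) I (chosenIn-∈ chh))

    noCrossing : Empty (ℒ a ∩ ℒ c) ⊎ (ℒ a ⊆ ℒ c ⊎ ℒ c ⊆ ℒ a) → h < f → ⊥
    noCrossing (inj₁ disjoint) h<f with x ≤? h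
    ... | yes x≤h = disjoint (h , x∈p∩q⁺ (consecutive a x h f x∈A f∈A x≤h (ℕ.<⇒≤ h<f) , h∈C))
    ... | no x≰h = disjoint (x , x∈p∩q⁺ (x∈A , consecutive c h x y h∈C y∈C (ℕ.<⇒≤ (ℕ.≰⇒> x≰h)) x≤y))
    noCrossing (inj₂ (inj₁ A⊆C)) h<f with f ≤? y
    ... | yes f≤y = ℕ.<⇒≱ h<f (chosenIn-max-below chh (x∈p∩q⁺ (A⊆C f∈A , f∈I)) f≤y)
    ... | no f≰y = ℕ.<⇒≱ h<f (chosenIn-min-above chf (ℕ.≤-<-trans x≤y y<f) (x∈p∩q⁺ (C⊆A h∈C , h∈I)))
      where
      y<f : y < f
      y<f = ℕ.≰⇒> f≰y
      C⊆A : ℒ c ⊆ ℒ a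
      C⊆A = minC a (consecutive a x y f x∈A f∈A x≤y (ℕ.<⇒≤ y<f)) A∩I≢∅
    noCrossing (inj₂ (inj₂ C⊆A)) h<f with x <? f
    ... | yes x<f = ℕ.<⇒≱ h<f (chosenIn-min-above chf x<f (x∈p∩q⁺ (C⊆A h∈C , h∈I)))
    ... | no x≮f = ℕ.<⇒≱ h<f (chosenIn-max-below chh (x∈p∩q⁺ (f∈C , f∈I)) f≤y)
      where
      f≤y : f ≤ y
      f≤y = ≤-trans (ℕ.≮⇒≥ x≮f) x≤y
      f∈C : f ∈ ℒ c
      f∈C = consecutive c h f y h∈C y∈C (ℕ.<⇒≤ h<f) f≤y

mainTheorem5 : ∀ {m n : ℕ} (ℒ : Fin m → Subset n) (b : Fin m → ℕ) →
    Laminar ℒ → (∀ (a : Fin m) → b a ≥ 1) → (∃ λ (a : Fin m) → ℒ a ≡ ⊤) →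
    Consecutive ℒ →
    (I : Subset n) → Independent ℒ b I → Nonempty I →
    ∀ (f : Fin n) → f ∈ I →
    Σ (Fin n) λ j → Σ (Fin n) λ k → j ≤ f × f ≤ k ×
    (∀ (x : Fin n) → (Assigned ℒ I x f → j ≤ x × x ≤ k) × (j ≤ x × x ≤ k → Assigned ℒ I x f))
mainTheorem5 ℒ _ laminar _ top consecutive I _ nonempty f f∈I =
  fibre-isInterval (Assigned ℒ I) (assigned-exists laminar top nonempty)
    (assigned-monotone laminar consecutive) (assigned-refl laminar top f∈I)
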